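{- Let $M\in\mathbb{K}\langle\langle\mathbb{X}\rangle\rangle$ with $\langle M,1\rangle=1$, and let $\mathscr{A}_M$ be the series of $M$-enriched shift-plethystic trees, defined by the implicit equation $\mathscr{A}_M=X_0\,(M\circ_s\mathscr{A}_M)$. Then the shift-plethystic inverse of $\mathscr{A}_M$ is $$(\mathscr{A}_M)^{\langle-1\rangle}=X_0M^{ -1}.$$
   Context: $\mathbb{X}=\{X_0,X_1,X_2,\dots\}$, $\mathbb{K}$ a field of characteristic zero. $\sigma$ is the continuous algebra endomorphism with $\sigma X_i=X_{i+1}$. For a series $R$ with zero constant term and $T=\sum_\kappa\langle T,X_\kappa\rangle X_\kappa$ ($\kappa$ ranging over finite sequences of nonnegative integers, $X_\kappa=X_{\kappa_1}\cdots X_{\kappa_l}$), the shift plethysm is $T\circ_sR=\sum_\kappa\langle T,X_\kappa\rangle(\sigma^{\kappa_1}R)\cdots(\sigma^{\kappa_l}R)$; it is associative with identity $X_0$. The shift-plethystic inverse $R^{\langle-1\rangle}$ of $R$ is the series with $R\circ_sR^{\langle-1\rangle}=R^{\langle-1\rangle}\circ_sR=X_0$. -}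

module Defs where

open import Level using (_⊔_)
open import Algebra.Bundles using (CommutativeRing)
open import Data.Nat as ℕ using (ℕ; zero; suc; _≤_; _∸_)
open import Data.Nat.Properties using (_≤?_)
open import Data.List using (List; []; _∷_; map; foldr; concatMap; upTo)
open import Data.Product using (Σ; _×_; _,_)
open import Data.Bool using (Bool; true; _∧_; if_then_else_)
open import Relation.Nullary using (¬_)
open import Relation.Nullary.Decidable using (⌊_⌋)

IsField : ∀ {c ℓ} → CommutativeRing c ℓ → Set (c ⊔ ℓ)
IsField K = (¬ (1# ≈ 0#)) × (∀ x → ¬ (x ≈ 0#) → Σ Carrier (λ y → (x * y) ≈ 1#))
  where open CommutativeRing K

CharZero : ∀ {c ℓ} → CommutativeRing c ℓ → Set ℓ
CharZero K = ∀ (n : ℕ) → ¬ (natK (suc n) ≈ 0#)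
  where
  open CommutativeRing K
  natK : ℕ → Carrier
  natK zero    = 0#
  natK (suc n) = 1# + natK n

-- Noncommutative formal power series in X₀, X₁, X₂, … over K.
-- A word X_{i₁}⋯X_{iₗ} is the list (i₁ ∷ … ∷ iₗ ∷ []); a series is its
-- coefficient function.
module Series {c ℓ} (K : CommutativeRing c ℓ) where
  open CommutativeRing K

  Word : Set
  Word = List ℕ

  Ser : Set c
  Ser = Word → Carrier

  _≋_ : Ser → Ser → Set ℓ
  S ≋ T = ∀ w → S w ≈ T w

  Σl : List Carrier → Carrier
  Σl = foldr _+_ 0#

  splits : Word → List (Word × Word)
  splits []       = ([] , []) ∷ []
  splits (x ∷ xs) = ([] , x ∷ xs) ∷ map (λ { (u , v) → (x ∷ u , v) }) (splits xs)

  -- ordered factorisations of w into nonempty consecutive factors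
  ext : ℕ → List Word → List (List Word)
  ext x []       = ((x ∷ []) ∷ []) ∷ []
  ext x (p ∷ ps) = ((x ∷ []) ∷ p ∷ ps) ∷ ((x ∷ p) ∷ ps) ∷ []

  comps : Word → List (List Word)
  comps []       = [] ∷ []
  comps (x ∷ xs) = concatMap (ext x) (comps xs)

  one : Ser
  one []      = 1#
  one (_ ∷ _) = 0#

  X₀ : Ser
  X₀ (zero ∷ []) = 1#
  X₀ _           = 0#

  _·_ : Ser → Ser → Ser
  (S · T) w = Σl (map (λ { (u , v) → S u * T v }) (splits w))

  X₀· : Ser → Ser
  X₀· S (zero ∷ w) = S w
  X₀· S _          = 0#

  -- σ^k R : the endomorphism X_i ↦ X_{i+k} applied to R
  allGe : ℕ → Word → Bool
  allGe k []       = true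
  allGe k (i ∷ is) = ⌊ k ≤? i ⌋ ∧ allGe k is

  σ^ : ℕ → Ser → Ser
  σ^ k R w = if allGe k w then R (map (_∸ k) w) else 0#

  maxL : Word → ℕ
  maxL = foldr ℕ._⊔_ 0

  -- Given factors w₁,…,wₗ, computes
  --   Σ_{κ} ⟨T,X_κ⟩ ⟨σ^{κ₁}R,w₁⟩ ⋯ ⟨σ^{κₗ}R,wₗ⟩ ,
  -- where κᵢ ranges over 0..max(wᵢ) (larger κᵢ contribute 0).
  plethTerm : Ser → Ser → List Word → Carrier
  plethTerm T R []       = T []
  plethTerm T R (p ∷ ps) =
    Σl (map (λ k → σ^ k R p * plethTerm (λ κ → T (k ∷ κ)) R ps)
            (upTo (suc (maxL p))))

  -- shift plethysm T ∘ₛ R (for R with zero constant term):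
  -- ⟨T ∘ₛ R, w⟩ = Σ over factorisations of w into nonempty factors.
  _∘ₛ_ : Ser → Ser → Ser
  (T ∘ₛ R) w = Σl (map (plethTerm T R) (comps w))

-- Put B = X₀ M⁻¹. Shift plethysm is multiplicative in its left argument, and
-- (X₀ S) ∘ₛ R = R · (S ∘ₛ R) when R has no constant term, so
--   B ∘ₛ 𝒜 = 𝒜 · (M⁻¹ ∘ₛ 𝒜) = X₀ (M ∘ₛ 𝒜) (M⁻¹ ∘ₛ 𝒜) = X₀ ((M M⁻¹) ∘ₛ 𝒜) = X₀.
-- Conversely, by associativity 𝒜 ∘ₛ B solves Y = B · (M ∘ₛ Y), and so does X₀, the right unit
-- of ∘ₛ; as B has no constant term this equation determines Y word length by word length,
-- hence 𝒜 ∘ₛ B = X₀.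
-- The identities of the shift-plethystic calculus are proved by induction on word length,
-- through the left quotients ∂ⱼ and the chain rule ∂ⱼ (T ∘ₛ R) = ∑ₖ ∂ⱼ (σᵏ R) · (∂ₖ T ∘ₛ R).

module Submission where

open import Defs
open import Algebra.Bundles using (CommutativeRing)
open import Data.Bool using (true; false)
open import Data.Empty using (⊥-elim)
open import Data.Fin using (toℕ)
open import Data.Fin.Properties using (toℕ<n)
open import Data.List using (List; []; _∷_; _++_; map; concatMap; length; upTo; applyUpTo)
open import Data.Nat as ℕ using (ℕ; zero; suc; _≤_; _<_; _∸_; z≤n; s≤s)
import Data.Nat.Properties as ℕ
open import Data.Nat.Properties using (_≤?_)
open import Data.Product using (_×_; _,_; proj₂)
open import Data.Sum using (inj₁; inj₂)
open import Function using (_∘_; id)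
open import Relation.Binary.Bundles using (Setoid)
open import Relation.Binary.PropositionalEquality as ≡ using (_≡_; _≢_)
open import Relation.Nullary using (yes; no)
import Relation.Binary.Reasoning.Setoid as SetoidReasoning
open import Relation.Binary.Reasoning.Syntax using (module ≋-syntax)

module ShiftPlethysm {c ℓ} (K : CommutativeRing c ℓ) where
  open CommutativeRing K hiding (zero)
  open Series K
  open import Algebra.Properties.Semiring.Sum semiring
    using (sum; sum-cong-≋; sum-replicate-zero; ∑-distrib-+; ∑-comm; *-distribˡ-sum; *-distribʳ-sum)
  open import Algebra.Properties.CommutativeSemigroup +-commutativeSemigroup using (interchange)
  open import Algebra.Properties.CommutativeSemigroup *-commutativeSemigroup using (x∙yz≈y∙xz)

  -- Finite sums

  ∑< : ℕ → (ℕ → Carrier) → Carrier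
  ∑< n f = sum {n} (f ∘ toℕ)

  ∑<-cong : ∀ n {f g} → (∀ k → k < n → f k ≈ g k) → ∑< n f ≈ ∑< n g
  ∑<-cong n f≈g = sum-cong-≋ (λ i → f≈g (toℕ i) (toℕ<n i))

  ∑<-zero : ∀ n {f} → (∀ k → k < n → f k ≈ 0#) → ∑< n f ≈ 0#
  ∑<-zero n f≈0 = trans (∑<-cong n f≈0) (sum-replicate-zero n)

  ∑<-distrib-+ : ∀ n f g → ∑< n (λ k → f k + g k) ≈ ∑< n f + ∑< n g
  ∑<-distrib-+ n f g = ∑-distrib-+ {n} (f ∘ toℕ) (g ∘ toℕ)

  ∑<-comm : ∀ m n (f : ℕ → ℕ → Carrier) →
            ∑< m (λ i → ∑< n (f i)) ≈ ∑< n (λ j → ∑< m (λ i → f i j))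
  ∑<-comm m n f = ∑-comm {m} {n} (λ i j → f (toℕ i) (toℕ j))

  *-distribˡ-∑< : ∀ n x f → x * ∑< n f ≈ ∑< n (λ k → x * f k)
  *-distribˡ-∑< n x f = *-distribˡ-sum {n} x (f ∘ toℕ)

  *-distribʳ-∑< : ∀ n x f → ∑< n f * x ≈ ∑< n (λ k → f k * x)
  *-distribʳ-∑< n x f = *-distribʳ-sum {n} x (f ∘ toℕ)

  ∑<-+ : ∀ m n f → ∑< (m ℕ.+ n) f ≈ ∑< m f + ∑< n (λ k → f (m ℕ.+ k))
  ∑<-+ zero    n f = sym (+-identityˡ _)
  ∑<-+ (suc m) n f = trans (+-congˡ (∑<-+ m n (f ∘ suc))) (sym (+-assoc _ _ _))

  ∑<-single : ∀ N f j → j < N → (∀ k → k ≢ j → f k ≈ 0#) → ∑< N f ≈ f j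
  ∑<-single (suc N) f zero    _         f≈0 =
    trans (+-congˡ (∑<-zero N (λ k _ → f≈0 (suc k) (λ ())))) (+-identityʳ _)
  ∑<-single (suc N) f (suc j) (s≤s j<N) f≈0 =
    trans (+-congʳ (f≈0 0 (λ ()))) (trans (+-identityˡ _)
      (∑<-single N (f ∘ suc) j j<N (λ k k≢j → f≈0 (suc k) (k≢j ∘ ℕ.suc-injective))))

  ∑<-truncate : ∀ N f j → j < N → (∀ k → j < k → f k ≈ 0#) → ∑< N f ≈ ∑< (suc j) f
  ∑<-truncate N f j j<N f≈0 = begin
    ∑< N f                        ≡⟨ ≡.cong (λ n → ∑< n f) (≡.sym (ℕ.m+[n∸m]≡n j<N)) ⟩
    ∑< (suc j ℕ.+ d) f            ≈⟨ ∑<-+ (suc j) d f ⟩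
    ∑< (suc j) f + ∑< d (λ k → f (suc j ℕ.+ k))
      ≈⟨ +-congˡ (∑<-zero d (λ k _ → f≈0 (suc j ℕ.+ k) (s≤s (ℕ.m≤m+n j k)))) ⟩
    ∑< (suc j) f + 0#             ≈⟨ +-identityʳ _ ⟩
    ∑< (suc j) f                  ∎
    where
    open SetoidReasoning setoid
    d = N ∸ suc j

  ∑ᴸ : {A : Set} → (A → Carrier) → List A → Carrier
  ∑ᴸ f xs = Σl (map f xs)

  module _ {A : Set} where

    ∑ᴸ-cong : ∀ {f g : A → Carrier} xs → (∀ x → f x ≈ g x) → ∑ᴸ f xs ≈ ∑ᴸ g xs
    ∑ᴸ-cong []       f≈g = refl
    ∑ᴸ-cong (x ∷ xs) f≈g = +-cong (f≈g x) (∑ᴸ-cong xs f≈g)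

    ∑ᴸ-zero : ∀ {f : A → Carrier} xs → (∀ x → f x ≈ 0#) → ∑ᴸ f xs ≈ 0#
    ∑ᴸ-zero []       f≈0 = refl
    ∑ᴸ-zero (x ∷ xs) f≈0 = trans (+-cong (f≈0 x) (∑ᴸ-zero xs f≈0)) (+-identityˡ 0#)

    ∑ᴸ-distrib-+ : ∀ (f g : A → Carrier) xs → ∑ᴸ (λ x → f x + g x) xs ≈ ∑ᴸ f xs + ∑ᴸ g xs
    ∑ᴸ-distrib-+ f g []       = sym (+-identityˡ 0#)
    ∑ᴸ-distrib-+ f g (x ∷ xs) = trans (+-congˡ (∑ᴸ-distrib-+ f g xs)) (interchange _ _ _ _)

    *-distribˡ-∑ᴸ : ∀ a (f : A → Carrier) xs → a * ∑ᴸ f xs ≈ ∑ᴸ (λ x → a * f x) xs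
    *-distribˡ-∑ᴸ a f []       = zeroʳ a
    *-distribˡ-∑ᴸ a f (x ∷ xs) = trans (distribˡ a _ _) (+-congˡ (*-distribˡ-∑ᴸ a f xs))

    ∑ᴸ-++ : ∀ (f : A → Carrier) xs ys → ∑ᴸ f (xs ++ ys) ≈ ∑ᴸ f xs + ∑ᴸ f ys
    ∑ᴸ-++ f []       ys = sym (+-identityˡ _)
    ∑ᴸ-++ f (x ∷ xs) ys = trans (+-congˡ (∑ᴸ-++ f xs ys)) (sym (+-assoc _ _ _))

    ∑ᴸ-∑< : ∀ n (F : A → ℕ → Carrier) xs →
            ∑ᴸ (λ x → ∑< n (F x)) xs ≈ ∑< n (λ k → ∑ᴸ (λ x → F x k) xs)
    ∑ᴸ-∑< n F []       = sym (∑<-zero n (λ _ _ → refl))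
    ∑ᴸ-∑< n F (x ∷ xs) = trans (+-congˡ (∑ᴸ-∑< n F xs))
                               (sym (∑<-distrib-+ n (F x) (λ k → ∑ᴸ (λ y → F y k) xs)))

  ∑ᴸ-map : ∀ {A B : Set} (f : B → Carrier) (g : A → B) xs → ∑ᴸ f (map g xs) ≡ ∑ᴸ (f ∘ g) xs
  ∑ᴸ-map f g []       = ≡.refl
  ∑ᴸ-map f g (x ∷ xs) = ≡.cong (f (g x) +_) (∑ᴸ-map f g xs)

  ∑ᴸ-concatMap : ∀ {A B : Set} (f : B → Carrier) (g : A → List B) xs →
                 ∑ᴸ f (concatMap g xs) ≈ ∑ᴸ (λ x → ∑ᴸ f (g x)) xs
  ∑ᴸ-concatMap f g []       = refl
  ∑ᴸ-concatMap f g (x ∷ xs) =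
    trans (∑ᴸ-++ f (g x) (concatMap g xs)) (+-congˡ (∑ᴸ-concatMap f g xs))

  -- Series

  0ˢ : Ser
  0ˢ _ = 0#

  infixl 6 _+ˢ_
  _+ˢ_ : Ser → Ser → Ser
  (S +ˢ T) w = S w + T w

  infixr 7 _•_
  _•_ : Carrier → Ser → Ser
  (a • S) w = a * S w

  ∑ˢ : ℕ → (ℕ → Ser) → Ser
  ∑ˢ n F w = ∑< n (λ k → F k w)

  -- S = ⟨S,1⟩ + ∑ₖ Xₖ (∂ k S)
  ∂ : ℕ → Ser → Ser
  ∂ k S w = S (k ∷ w)

  ≋-setoid : Setoid c ℓ
  ≋-setoid = record
    { Carrier       = Ser
    ; _≈_           = _≋_
    ; isEquivalence = record
      { refl  = λ _ → refl
      ; sym   = λ S≋T w → sym (S≋T w)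
      ; trans = λ S≋T T≋U w → trans (S≋T w) (T≋U w)
      }
    }

  open Setoid ≋-setoid public using ()
    renaming (refl to ≋-refl; sym to ≋-sym; trans to ≋-trans; reflexive to ≋-reflexive)

  ∂-cong : ∀ k {S T} → S ≋ T → ∂ k S ≋ ∂ k T
  ∂-cong k S≋T w = S≋T (k ∷ w)

  +ˢ-cong : ∀ {A A′ B B′} → A ≋ A′ → B ≋ B′ → (A +ˢ B) ≋ (A′ +ˢ B′)
  +ˢ-cong A≋A′ B≋B′ w = +-cong (A≋A′ w) (B≋B′ w)

  +ˢ-identityʳ : ∀ A → (A +ˢ 0ˢ) ≋ A
  +ˢ-identityʳ A w = +-identityʳ (A w)

  •-congˡ : ∀ a {A A′} → A ≋ A′ → (a • A) ≋ (a • A′)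
  •-congˡ a A≋A′ w = *-congˡ (A≋A′ w)

  •-congʳ : ∀ {a b} A → a ≈ b → (a • A) ≋ (b • A)
  •-congʳ A a≈b w = *-congʳ a≈b

  •-zeroʳ : ∀ a → (a • 0ˢ) ≋ 0ˢ
  •-zeroʳ a w = zeroʳ a

  ∑ˢ-cong : ∀ n {F G} → (∀ k → k < n → F k ≋ G k) → ∑ˢ n F ≋ ∑ˢ n G
  ∑ˢ-cong n F≋G w = ∑<-cong n (λ k k<n → F≋G k k<n w)

  ∑ˢ-zero : ∀ n {F} → (∀ k → k < n → F k ≋ 0ˢ) → ∑ˢ n F ≋ 0ˢ
  ∑ˢ-zero n F≋0 w = ∑<-zero n (λ k k<n → F≋0 k k<n w)

  ∑ˢ-single : ∀ N F j → j < N → (∀ k → k ≢ j → F k ≋ 0ˢ) → ∑ˢ N F ≋ F j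
  ∑ˢ-single N F j j<N F≋0 w = ∑<-single N (λ k → F k w) j j<N (λ k k≢j → F≋0 k k≢j w)

  ∑ˢ-+ : ∀ m n F → ∑ˢ (m ℕ.+ n) F ≋ (∑ˢ m F +ˢ ∑ˢ n (λ k → F (m ℕ.+ k)))
  ∑ˢ-+ m n F w = ∑<-+ m n (λ k → F k w)

  ∑ˢ-distrib-+ˢ : ∀ n F G → ∑ˢ n (λ k → F k +ˢ G k) ≋ (∑ˢ n F +ˢ ∑ˢ n G)
  ∑ˢ-distrib-+ˢ n F G w = ∑<-distrib-+ n (λ k → F k w) (λ k → G k w)

  •-distrib-∑ˢ : ∀ n a F → (a • ∑ˢ n F) ≋ ∑ˢ n (λ k → a • F k)
  •-distrib-∑ˢ n a F w = *-distribˡ-∑< n a (λ k → F k w)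

  ∑ˢ-comm : ∀ m n (F : ℕ → ℕ → Ser) →
            ∑ˢ m (λ i → ∑ˢ n (F i)) ≋ ∑ˢ n (λ j → ∑ˢ m (λ i → F i j))
  ∑ˢ-comm m n F w = ∑<-comm m n (λ i j → F i j w)

  -- Cauchy product

  ·-[] : ∀ S T → (S · T) [] ≈ S [] * T []
  ·-[] S T = +-identityʳ _

  ∂-· : ∀ k S T → ∂ k (S · T) ≋ (∂ k S · T +ˢ S [] • ∂ k T)
  ∂-· k S T w = trans (+-congˡ (reflexive (∑ᴸ-map _ _ (splits w)))) (+-comm _ _)

  ·-cong : ∀ {S S′ T T′} → S ≋ S′ → T ≋ T′ → (S · T) ≋ (S′ · T′)
  ·-cong S≋S′ T≋T′ w = ∑ᴸ-cong (splits w) (λ (u , v) → *-cong (S≋S′ u) (T≋T′ v))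

  ·-congˡ : ∀ S {T T′} → T ≋ T′ → (S · T) ≋ (S · T′)
  ·-congˡ S = ·-cong {S} ≋-refl

  ·-congʳ : ∀ {S S′} T → S ≋ S′ → (S · T) ≋ (S′ · T)
  ·-congʳ T S≋S′ = ·-cong S≋S′ (≋-refl {T})

  ·-zeroˡ : ∀ S → (0ˢ · S) ≋ 0ˢ
  ·-zeroˡ S w = ∑ᴸ-zero (splits w) (λ _ → zeroˡ _)

  ·-zeroʳ : ∀ S → (S · 0ˢ) ≋ 0ˢ
  ·-zeroʳ S w = ∑ᴸ-zero (splits w) (λ _ → zeroʳ _)

  ·-distribˡ-+ˢ : ∀ S A B → (S · (A +ˢ B)) ≋ (S · A +ˢ S · B)
  ·-distribˡ-+ˢ S A B w =
    trans (∑ᴸ-cong (splits w) (λ _ → distribˡ _ _ _)) (∑ᴸ-distrib-+ _ _ (splits w))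

  ·-distribʳ-+ˢ : ∀ S A B → ((A +ˢ B) · S) ≋ (A · S +ˢ B · S)
  ·-distribʳ-+ˢ S A B w =
    trans (∑ᴸ-cong (splits w) (λ _ → distribʳ _ _ _)) (∑ᴸ-distrib-+ _ _ (splits w))

  ·-distribˡ-∑ˢ : ∀ n S F → (S · ∑ˢ n F) ≋ ∑ˢ n (λ k → S · F k)
  ·-distribˡ-∑ˢ n S F w =
    trans (∑ᴸ-cong (splits w) (λ (u , v) → *-distribˡ-∑< n (S u) (λ k → F k v)))
          (∑ᴸ-∑< n (λ (u , v) k → S u * F k v) (splits w))

  ·-distribʳ-∑ˢ : ∀ n S F → (∑ˢ n F · S) ≋ ∑ˢ n (λ k → F k · S)
  ·-distribʳ-∑ˢ n S F w =
    trans (∑ᴸ-cong (splits w) (λ (u , v) → *-distribʳ-∑< n (S v) (λ k → F k u)))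
          (∑ᴸ-∑< n (λ (u , v) k → F k u * S v) (splits w))

  •-·-assoc : ∀ a S T → ((a • S) · T) ≋ (a • (S · T))
  •-·-assoc a S T w =
    trans (∑ᴸ-cong (splits w) (λ _ → *-assoc _ _ _)) (sym (*-distribˡ-∑ᴸ a _ (splits w)))

  ·-•-comm : ∀ a S T → (S · (a • T)) ≋ (a • (S · T))
  ·-•-comm a S T w =
    trans (∑ᴸ-cong (splits w) (λ _ → x∙yz≈y∙xz _ _ _)) (sym (*-distribˡ-∑ᴸ a _ (splits w)))

  ·-identityˡ : ∀ S → (one · S) ≋ S
  ·-identityˡ S []      = trans (·-[] one S) (*-identityˡ _)
  ·-identityˡ S (k ∷ w) =
    trans (∂-· k one S w) (trans (+-cong (·-zeroˡ S w) (*-identityˡ _)) (+-identityˡ _))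

  infix 4 _≋[_]_
  _≋[_]_ : Ser → ℕ → Ser → Set ℓ
  S ≋[ zero  ] T = S [] ≈ T []
  S ≋[ suc n ] T = S [] ≈ T [] × (∀ k → ∂ k S ≋[ n ] ∂ k T)

  ≋[]-pred : ∀ n {S T} → S ≋[ suc n ] T → S ≋[ n ] T
  ≋[]-pred zero    (S≈T , _)   = S≈T
  ≋[]-pred (suc n) (S≈T , ∂≈) = S≈T , λ k → ≋[]-pred n (∂≈ k)

  ≋⇒≋[] : ∀ n {S T} → S ≋ T → S ≋[ n ] T
  ≋⇒≋[] zero    S≋T = S≋T []
  ≋⇒≋[] (suc n) S≋T = S≋T [] , λ k → ≋⇒≋[] n (∂-cong k S≋T)

  ≋[]⇒≋ : ∀ {S T} → (∀ n → S ≋[ n ] T) → S ≋ T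
  ≋[]⇒≋ S≈T w = at w (S≈T (length w))
    where
    at : ∀ {S T} w → S ≋[ length w ] T → S w ≈ T w
    at []      S≈T       = S≈T
    at (k ∷ w) (_ , ∂≈) = at w (∂≈ k)

  ≋[_]-setoid : ℕ → Setoid c ℓ
  ≋[ n ]-setoid = record
    { Carrier       = Ser
    ; _≈_           = _≋[ n ]_
    ; isEquivalence = record { refl = ≋⇒≋[] n ≋-refl ; sym = sym[] n ; trans = trans[] n }
    }
    where
    sym[] : ∀ n {S T} → S ≋[ n ] T → T ≋[ n ] S
    sym[] zero    S≈T        = sym S≈T
    sym[] (suc n) (S≈T , ∂≈) = sym S≈T , λ k → sym[] n (∂≈ k)
    trans[] : ∀ n {S T U} → S ≋[ n ] T → T ≋[ n ] U → S ≋[ n ] U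
    trans[] zero    S≈T        T≈U        = trans S≈T T≈U
    trans[] (suc n) (S≈T , ∂≈) (T≈U , ∂≈′) =
      trans S≈T T≈U , λ k → trans[] n (∂≈ k) (∂≈′ k)

  module ≋[]-Reasoning (n : ℕ) where
    open SetoidReasoning ≋[ n ]-setoid public
    open ≋-syntax _IsRelatedTo_ _IsRelatedTo_ (λ S≋T → ≈-go (≋⇒≋[] n S≋T)) ≋-sym public

  ≋[]-refl : ∀ n {S} → S ≋[ n ] S
  ≋[]-refl n = Setoid.refl ≋[ n ]-setoid

  ≋[]-trans : ∀ n {S T U} → S ≋[ n ] T → T ≋[ n ] U → S ≋[ n ] U
  ≋[]-trans n = Setoid.trans ≋[ n ]-setoid

  +ˢ-cong[] : ∀ n {A A′ B B′} → A ≋[ n ] A′ → B ≋[ n ] B′ → A +ˢ B ≋[ n ] A′ +ˢ B′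
  +ˢ-cong[] zero    A≈A′ B≈B′ = +-cong A≈A′ B≈B′
  +ˢ-cong[] (suc n) (A≈A′ , ∂A) (B≈B′ , ∂B) =
    +-cong A≈A′ B≈B′ , λ k → +ˢ-cong[] n (∂A k) (∂B k)

  •-cong[] : ∀ n {a b A A′} → a ≈ b → A ≋[ n ] A′ → a • A ≋[ n ] b • A′
  •-cong[] zero    a≈b A≈A′       = *-cong a≈b A≈A′
  •-cong[] (suc n) a≈b (A≈A′ , ∂A) = *-cong a≈b A≈A′ , λ k → •-cong[] n a≈b (∂A k)

  ∑ˢ-cong[] : ∀ n N {F G} → (∀ k → F k ≋[ n ] G k) → ∑ˢ N F ≋[ n ] ∑ˢ N G
  ∑ˢ-cong[] n zero    F≈G = ≋[]-refl n
  ∑ˢ-cong[] n (suc N) F≈G = +ˢ-cong[] n (F≈G 0) (∑ˢ-cong[] n N (F≈G ∘ suc))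

  ·-cong[] : ∀ n {A A′ B B′} → A ≋[ n ] A′ → B ≋[ n ] B′ → A · B ≋[ n ] A′ · B′
  ·-cong[] zero {A} {A′} {B} {B′} A≈A′ B≈B′ =
    trans (·-[] A B) (trans (*-cong A≈A′ B≈B′) (sym (·-[] A′ B′)))
  ·-cong[] (suc n) {A} {A′} {B} {B′} (A[]≈ , ∂A) B≈B′@(B[]≈ , ∂B) =
    ·-cong[] zero {A} {A′} {B} {B′} A[]≈ B[]≈ , λ k → begin
      ∂ k (A · B)
        ≋⟨ ∂-· k A B ⟩
      ∂ k A · B +ˢ A [] • ∂ k B
        ≈⟨ +ˢ-cong[] n (·-cong[] n (∂A k) (≋[]-pred n B≈B′)) (•-cong[] n A[]≈ (∂B k)) ⟩
      ∂ k A′ · B′ +ˢ A′ [] • ∂ k B′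
        ≋⟨ ∂-· k A′ B′ ⟨
      ∂ k (A′ · B′)
        ∎
    where open ≋[]-Reasoning n

  ·-assoc : ∀ A B C → ((A · B) · C) ≋ (A · (B · C))
  ·-assoc A B C = ≋[]⇒≋ (λ n → assoc[] n A B C)
    where
    assoc-[] : ∀ A B C → ((A · B) · C) [] ≈ (A · (B · C)) []
    assoc-[] A B C = begin
      ((A · B) · C) []         ≈⟨ trans (·-[] (A · B) C) (*-congʳ (·-[] A B)) ⟩
      (A [] * B []) * C []     ≈⟨ *-assoc _ _ _ ⟩
      A [] * (B [] * C [])     ≈⟨ trans (·-[] A (B · C)) (*-congˡ (·-[] B C)) ⟨
      (A · (B · C)) []         ∎
      where open SetoidReasoning setoid
    assoc[] : ∀ n A B C → (A · B) · C ≋[ n ] A · (B · C)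
    assoc[] zero    A B C = assoc-[] A B C
    assoc[] (suc n) A B C = assoc-[] A B C , λ k → begin
      ∂ k ((A · B) · C)
        ≋⟨ ∂-· k (A · B) C ⟩
      ∂ k (A · B) · C +ˢ (A · B) [] • ∂ k C
        ≋⟨ +ˢ-cong (·-congʳ C (∂-· k A B)) (•-congʳ (∂ k C) (·-[] A B)) ⟩
      (∂ k A · B +ˢ A [] • ∂ k B) · C +ˢ (A [] * B []) • ∂ k C
        ≋⟨ +ˢ-cong (≋-trans (·-distribʳ-+ˢ C _ _) (+ˢ-cong ≋-refl (•-·-assoc _ _ _))) ≋-refl ⟩
      (∂ k A · B) · C +ˢ A [] • (∂ k B · C) +ˢ (A [] * B []) • ∂ k C
        ≈⟨ +ˢ-cong[] n (+ˢ-cong[] n (assoc[] n (∂ k A) B C) (≋[]-refl n)) (≋[]-refl n) ⟩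
      ∂ k A · (B · C) +ˢ A [] • (∂ k B · C) +ˢ (A [] * B []) • ∂ k C
        ≋⟨ (λ w → trans (+-assoc _ _ _)
                        (+-congˡ (trans (+-congˡ (*-assoc _ _ _)) (sym (distribˡ _ _ _))))) ⟩
      ∂ k A · (B · C) +ˢ A [] • (∂ k B · C +ˢ B [] • ∂ k C)
        ≋⟨ +ˢ-cong ≋-refl (•-congˡ (A []) (∂-· k B C)) ⟨
      ∂ k A · (B · C) +ˢ A [] • ∂ k (B · C)
        ≋⟨ ∂-· k A (B · C) ⟨
      ∂ k (A · (B · C))
        ∎
      where open ≋[]-Reasoning n

  -- The shifts σᵐ

  ∂-σ^-≥ : ∀ m j R → m ≤ j → ∂ j (σ^ m R) ≋ σ^ m (∂ (j ∸ m) R)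
  ∂-σ^-≥ m j R m≤j w with m ≤? j
  ... | yes _   = refl
  ... | no  m≰j = ⊥-elim (m≰j m≤j)

  ∂-σ^-< : ∀ m j R → j < m → ∂ j (σ^ m R) ≋ 0ˢ
  ∂-σ^-< m j R j<m w with m ≤? j
  ... | yes m≤j = ⊥-elim (ℕ.<⇒≱ j<m m≤j)
  ... | no  _   = refl

  σ^-cong : ∀ m {R R′} → R ≋ R′ → σ^ m R ≋ σ^ m R′
  σ^-cong m R≋R′ w with allGe m w
  ... | true  = R≋R′ _
  ... | false = refl

  σ^-+ˢ : ∀ m A B → σ^ m (A +ˢ B) ≋ (σ^ m A +ˢ σ^ m B)
  σ^-+ˢ m A B w with allGe m w
  ... | true  = refl
  ... | false = sym (+-identityˡ 0#)

  σ^-• : ∀ m a A → σ^ m (a • A) ≋ (a • σ^ m A)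
  σ^-• m a A w with allGe m w
  ... | true  = refl
  ... | false = sym (zeroʳ a)

  σ^-0ˢ : ∀ m → σ^ m 0ˢ ≋ 0ˢ
  σ^-0ˢ m w with allGe m w
  ... | true  = refl
  ... | false = refl

  σ^-∑ˢ : ∀ m N F → σ^ m (∑ˢ N F) ≋ ∑ˢ N (λ k → σ^ m (F k))
  σ^-∑ˢ m N F w with allGe m w
  ... | true  = refl
  ... | false = sym (∑<-zero N (λ _ _ → refl))

  σ^-one : ∀ m → σ^ m one ≋ one
  σ^-one m []      = refl
  σ^-one m (j ∷ w) with allGe m (j ∷ w)
  ... | true  = refl
  ... | false = refl

  σ^-cong[] : ∀ n m {R R′} → R ≋[ n ] R′ → σ^ m R ≋[ n ] σ^ m R′
  σ^-cong[] zero    m R≈R′        = R≈R′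
  σ^-cong[] (suc n) m {R} {R′} (R[]≈ , ∂R) = R[]≈ , ∂σ
    where
    ∂σ : ∀ j → ∂ j (σ^ m R) ≋[ n ] ∂ j (σ^ m R′)
    ∂σ j with ℕ.≤-<-connex m j
    ... | inj₁ m≤j = begin
      ∂ j (σ^ m R)             ≋⟨ ∂-σ^-≥ m j R m≤j ⟩
      σ^ m (∂ (j ∸ m) R)       ≈⟨ σ^-cong[] n m (∂R (j ∸ m)) ⟩
      σ^ m (∂ (j ∸ m) R′)      ≋⟨ ∂-σ^-≥ m j R′ m≤j ⟨
      ∂ j (σ^ m R′)            ∎
      where open ≋[]-Reasoning n
    ... | inj₂ j<m = ≋⇒≋[] n (≋-trans (∂-σ^-< m j R j<m) (≋-sym (∂-σ^-< m j R′ j<m)))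

  σ^-zero : ∀ R → σ^ 0 R ≋ R
  σ^-zero R = ≋[]⇒≋ (λ n → σ^0[] n R)
    where
    σ^0[] : ∀ n R → σ^ 0 R ≋[ n ] R
    σ^0[] zero    R = refl
    σ^0[] (suc n) R = refl , λ j →
      ≋[]-trans n (≋⇒≋[] n (∂-σ^-≥ 0 j R z≤n)) (σ^0[] n (∂ j R))

  σ^-· : ∀ m A B → σ^ m (A · B) ≋ (σ^ m A · σ^ m B)
  σ^-· m A B = ≋[]⇒≋ (λ n → σ^-·[] n A B)
    where
    σ^-·-[] : ∀ A B → σ^ m (A · B) [] ≈ (σ^ m A · σ^ m B) []
    σ^-·-[] A B = trans (·-[] A B) (sym (·-[] (σ^ m A) (σ^ m B)))
    σ^-·[] : ∀ n A B → σ^ m (A · B) ≋[ n ] σ^ m A · σ^ m B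
    σ^-·[] zero    A B = σ^-·-[] A B
    σ^-·[] (suc n) A B = σ^-·-[] A B , ∂σ
      where
      ∂σ : ∀ j → ∂ j (σ^ m (A · B)) ≋[ n ] ∂ j (σ^ m A · σ^ m B)
      ∂σ j with ℕ.≤-<-connex m j
      ... | inj₁ m≤j = begin
        ∂ j (σ^ m (A · B))
          ≋⟨ ≋-trans (∂-σ^-≥ m j (A · B) m≤j) (σ^-cong m (∂-· i A B)) ⟩
        σ^ m (∂ i A · B +ˢ A [] • ∂ i B)
          ≋⟨ ≋-trans (σ^-+ˢ m (∂ i A · B) (A [] • ∂ i B)) (+ˢ-cong ≋-refl (σ^-• m (A []) (∂ i B))) ⟩
        σ^ m (∂ i A · B) +ˢ A [] • σ^ m (∂ i B)
          ≈⟨ +ˢ-cong[] n (σ^-·[] n (∂ i A) B) (≋[]-refl n) ⟩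
        σ^ m (∂ i A) · σ^ m B +ˢ A [] • σ^ m (∂ i B)
          ≋⟨ +ˢ-cong (·-congʳ (σ^ m B) (∂-σ^-≥ m j A m≤j)) (•-congˡ (A []) (∂-σ^-≥ m j B m≤j)) ⟨
        ∂ j (σ^ m A) · σ^ m B +ˢ σ^ m A [] • ∂ j (σ^ m B)
          ≋⟨ ∂-· j (σ^ m A) (σ^ m B) ⟨
        ∂ j (σ^ m A · σ^ m B)
          ∎
        where
        open ≋[]-Reasoning n
        i = j ∸ m
      ... | inj₂ j<m = ≋⇒≋[] n (begin
        ∂ j (σ^ m (A · B))
          ≈⟨ ∂-σ^-< m j (A · B) j<m ⟩
        0ˢ
          ≈⟨ ≋-trans (+ˢ-cong (·-zeroˡ _) (•-zeroʳ _)) (+ˢ-identityʳ 0ˢ) ⟨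
        0ˢ · σ^ m B +ˢ σ^ m A [] • 0ˢ
          ≈⟨ +ˢ-cong (·-congʳ (σ^ m B) (∂-σ^-< m j A j<m)) (•-congˡ _ (∂-σ^-< m j B j<m)) ⟨
        ∂ j (σ^ m A) · σ^ m B +ˢ σ^ m A [] • ∂ j (σ^ m B)
          ≈⟨ ∂-· j (σ^ m A) (σ^ m B) ⟨
        ∂ j (σ^ m A · σ^ m B)
          ∎)
        where open SetoidReasoning ≋-setoid

  σ^-σ^ : ∀ k m R → σ^ k (σ^ m R) ≋ σ^ (k ℕ.+ m) R
  σ^-σ^ k m R = ≋[]⇒≋ (λ n → σσ[] n R)
    where
    σσ[] : ∀ n R → σ^ k (σ^ m R) ≋[ n ] σ^ (k ℕ.+ m) R
    σσ[] zero    R = refl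
    σσ[] (suc n) R = refl , ∂σσ
      where
      ∂σσ : ∀ j → ∂ j (σ^ k (σ^ m R)) ≋[ n ] ∂ j (σ^ (k ℕ.+ m) R)
      ∂σσ j with ℕ.≤-<-connex k j
      ... | inj₂ j<k = ≋⇒≋[] n (≋-trans (∂-σ^-< k j (σ^ m R) j<k)
                                 (≋-sym (∂-σ^-< (k ℕ.+ m) j R (ℕ.<-≤-trans j<k (ℕ.m≤m+n k m)))))
      ... | inj₁ k≤j with ℕ.≤-<-connex m (j ∸ k)
      ...   | inj₁ m≤j∸k = begin
        ∂ j (σ^ k (σ^ m R))
          ≋⟨ ≋-trans (∂-σ^-≥ k j (σ^ m R) k≤j) (σ^-cong k (∂-σ^-≥ m (j ∸ k) R m≤j∸k)) ⟩
        σ^ k (σ^ m (∂ (j ∸ k ∸ m) R))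
          ≈⟨ σσ[] n (∂ (j ∸ k ∸ m) R) ⟩
        σ^ (k ℕ.+ m) (∂ (j ∸ k ∸ m) R)
          ≡⟨ ≡.cong (λ i → σ^ (k ℕ.+ m) (∂ i R)) (ℕ.∸-+-assoc j k m) ⟩
        σ^ (k ℕ.+ m) (∂ (j ∸ (k ℕ.+ m)) R)
          ≋⟨ ∂-σ^-≥ (k ℕ.+ m) j R k+m≤j ⟨
        ∂ j (σ^ (k ℕ.+ m) R)
          ∎
        where
        open ≋[]-Reasoning n
        k+m≤j : k ℕ.+ m ≤ j
        k+m≤j = ≡.subst (k ℕ.+ m ≤_) (ℕ.m+[n∸m]≡n k≤j) (ℕ.+-monoʳ-≤ k m≤j∸k)
      ...   | inj₂ j∸k<m = ≋⇒≋[] n (begin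
        ∂ j (σ^ k (σ^ m R))
          ≈⟨ ≋-trans (∂-σ^-≥ k j (σ^ m R) k≤j) (σ^-cong k (∂-σ^-< m (j ∸ k) R j∸k<m)) ⟩
        σ^ k 0ˢ
          ≈⟨ σ^-0ˢ k ⟩
        0ˢ
          ≈⟨ ∂-σ^-< (k ℕ.+ m) j R j<k+m ⟨
        ∂ j (σ^ (k ℕ.+ m) R)
          ∎)
        where
        open SetoidReasoning ≋-setoid
        j<k+m : j < k ℕ.+ m
        j<k+m = ≡.subst (_< k ℕ.+ m) (ℕ.m+[n∸m]≡n k≤j) (ℕ.+-monoʳ-< k j∸k<m)

  ∂-σ^-+ : ∀ m l T → ∂ (m ℕ.+ l) (σ^ m T) ≋ σ^ m (∂ l T)
  ∂-σ^-+ m l T = ≋-trans (∂-σ^-≥ m (m ℕ.+ l) T (ℕ.m≤m+n m l))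
                         (≋-reflexive (≡.cong (λ i → σ^ m (∂ i T)) (ℕ.m+n∸m≡n m l)))

  -- Shift plethysm

  ∘ₛ-[] : ∀ T R → (T ∘ₛ R) [] ≈ T []
  ∘ₛ-[] T R = +-identityʳ _

  module _ (R : Ser) where

    plethTerm-cong : ∀ {T T′} → T ≋ T′ → ∀ ps → plethTerm T R ps ≈ plethTerm T′ R ps
    plethTerm-cong T≋T′ []       = T≋T′ []
    plethTerm-cong T≋T′ (p ∷ ps) =
      ∑ᴸ-cong (upTo (suc (maxL p))) (λ k → *-congˡ (plethTerm-cong (∂-cong k T≋T′) ps))

    plethTerm-+ˢ : ∀ A B ps → plethTerm (A +ˢ B) R ps ≈ plethTerm A R ps + plethTerm B R ps
    plethTerm-+ˢ A B []       = refl
    plethTerm-+ˢ A B (p ∷ ps) = trans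
      (∑ᴸ-cong (upTo (suc (maxL p))) (λ k →
        trans (*-congˡ (plethTerm-+ˢ (∂ k A) (∂ k B) ps)) (distribˡ _ _ _)))
      (∑ᴸ-distrib-+ _ _ (upTo (suc (maxL p))))

    plethTerm-• : ∀ a A ps → plethTerm (a • A) R ps ≈ a * plethTerm A R ps
    plethTerm-• a A []       = refl
    plethTerm-• a A (p ∷ ps) = trans
      (∑ᴸ-cong (upTo (suc (maxL p))) (λ k →
        trans (*-congˡ (plethTerm-• a (∂ k A) ps)) (x∙yz≈y∙xz _ _ _)))
      (sym (*-distribˡ-∑ᴸ a _ (upTo (suc (maxL p)))))

    plethTerm-0ˢ : ∀ ps → plethTerm 0ˢ R ps ≈ 0#
    plethTerm-0ˢ []       = refl
    plethTerm-0ˢ (p ∷ ps) =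
      ∑ᴸ-zero (upTo (suc (maxL p))) (λ k → trans (*-congˡ (plethTerm-0ˢ ps)) (zeroʳ _))

    ∘ₛ-congʳ : ∀ {T T′} → T ≋ T′ → (T ∘ₛ R) ≋ (T′ ∘ₛ R)
    ∘ₛ-congʳ T≋T′ w = ∑ᴸ-cong (comps w) (plethTerm-cong T≋T′)

    ∘ₛ-distribʳ-+ˢ : ∀ A B → ((A +ˢ B) ∘ₛ R) ≋ ((A ∘ₛ R) +ˢ (B ∘ₛ R))
    ∘ₛ-distribʳ-+ˢ A B w =
      trans (∑ᴸ-cong (comps w) (plethTerm-+ˢ A B)) (∑ᴸ-distrib-+ _ _ (comps w))

    ∘ₛ-• : ∀ a A → ((a • A) ∘ₛ R) ≋ (a • (A ∘ₛ R))
    ∘ₛ-• a A w = trans (∑ᴸ-cong (comps w) (plethTerm-• a A)) (sym (*-distribˡ-∑ᴸ a _ (comps w)))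

    ∘ₛ-zeroˡ : (0ˢ ∘ₛ R) ≋ 0ˢ
    ∘ₛ-zeroˡ w = ∑ᴸ-zero (comps w) plethTerm-0ˢ

    ·-∘ₛ-zeroˡ : ∀ S {T} → T ≋ 0ˢ → (S · (T ∘ₛ R)) ≋ 0ˢ
    ·-∘ₛ-zeroˡ S T≋0 = ≋-trans (·-congˡ S (≋-trans (∘ₛ-congʳ T≋0) ∘ₛ-zeroˡ)) (·-zeroʳ S)

    ∘ₛ-distribʳ-∑ˢ : ∀ N F → (∑ˢ N F ∘ₛ R) ≋ ∑ˢ N (λ k → F k ∘ₛ R)
    ∘ₛ-distribʳ-∑ˢ zero    F = ∘ₛ-zeroˡ
    ∘ₛ-distribʳ-∑ˢ (suc N) F =
      ≋-trans (∘ₛ-distribʳ-+ˢ (F 0) (∑ˢ N (F ∘ suc))) (+ˢ-cong ≋-refl (∘ₛ-distribʳ-∑ˢ N (F ∘ suc)))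

  ∑ᴸ-applyUpTo : ∀ (f : ℕ → Carrier) h n → ∑ᴸ f (applyUpTo h n) ≡ ∑< n (f ∘ h)
  ∑ᴸ-applyUpTo f h zero    = ≡.refl
  ∑ᴸ-applyUpTo f h (suc n) = ≡.cong (f (h 0) +_) (∑ᴸ-applyUpTo f (h ∘ suc) n)

  ∑ᴸ-comps-∷ : ∀ (Φ : Word → List Word → Carrier) (f : List Word → Carrier) →
               (∀ p ps → f (p ∷ ps) ≈ Φ p ps) → ∀ x w →
               ∑ᴸ f (comps (x ∷ w)) ≈ ∑ᴸ (λ (u , v) → ∑ᴸ (Φ (x ∷ u)) (comps v)) (splits w)
  ∑ᴸ-comps-∷ Φ f f≈Φ x w = begin
    ∑ᴸ f (comps (x ∷ w))                              ≈⟨ ∑ᴸ-concatMap f (ext x) (comps w) ⟩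
    ∑ᴸ (λ ps → ∑ᴸ f (ext x ps)) (comps w)             ≈⟨ ∑ᴸ-cong (comps w) ext-split ⟩
    ∑ᴸ (λ ps → Φ (x ∷ []) ps + longer ps) (comps w)   ≈⟨ ∑ᴸ-distrib-+ _ _ (comps w) ⟩
    ∑ᴸ (Φ (x ∷ [])) (comps w) + ∑ᴸ longer (comps w)   ≈⟨ by-first-factor w ⟩
    ∑ᴸ (λ (u , v) → ∑ᴸ (Φ (x ∷ u)) (comps v)) (splits w) ∎
    where
    open SetoidReasoning setoid
    longer : List Word → Carrier
    longer []       = 0#
    longer (p ∷ ps) = Φ (x ∷ p) ps
    ext-split : ∀ ps → ∑ᴸ f (ext x ps) ≈ Φ (x ∷ []) ps + longer ps
    ext-split []       = +-congʳ (f≈Φ _ _)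
    ext-split (p ∷ ps) = +-cong (f≈Φ _ _) (trans (+-identityʳ _) (f≈Φ _ _))
    by-first-factor : ∀ w → ∑ᴸ (Φ (x ∷ [])) (comps w) + ∑ᴸ longer (comps w) ≈
                            ∑ᴸ (λ (u , v) → ∑ᴸ (Φ (x ∷ u)) (comps v)) (splits w)
    by-first-factor []      = +-congˡ (+-identityʳ 0#)
    by-first-factor (y ∷ w) = +-congˡ (trans
      (∑ᴸ-comps-∷ (Φ ∘ (x ∷_)) longer (λ _ _ → refl) y w)
      (sym (reflexive (∑ᴸ-map _ _ (splits w)))))

  ∂-∘ₛ : ∀ T R j N → j < N → ∂ j (T ∘ₛ R) ≋ ∑ˢ N (λ k → ∂ j (σ^ k R) · (∂ k T ∘ₛ R))
  ∂-∘ₛ T R j N j<N w = begin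
    ∑ᴸ (plethTerm T R) (comps (j ∷ w))
      ≈⟨ ∑ᴸ-comps-∷ Φ (plethTerm T R) (λ p ps → reflexive (∑ᴸ-applyUpTo _ id (suc (maxL p)))) j w ⟩
    ∑ᴸ (λ (u , v) → ∑ᴸ (Φ (j ∷ u)) (comps v)) (splits w)
      ≈⟨ ∑ᴸ-cong (splits w) (λ (u , v) → ∑ᴸ-cong (comps v) (Φ-truncate u)) ⟩
    ∑ᴸ (λ (u , v) → ∑ᴸ (λ ps → ∑< N (term (j ∷ u) ps)) (comps v)) (splits w)
      ≈⟨ ∑ᴸ-cong (splits w) (λ (u , v) → ∑ᴸ-∑< N (term (j ∷ u)) (comps v)) ⟩
    ∑ᴸ (λ (u , v) → ∑< N (λ k → ∑ᴸ (λ ps → term (j ∷ u) ps k) (comps v))) (splits w)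
      ≈⟨ ∑ᴸ-cong (splits w) (λ (u , v) → ∑<-cong N (λ k _ →
           sym (*-distribˡ-∑ᴸ (σ^ k R (j ∷ u)) (plethTerm (∂ k T) R) (comps v)))) ⟩
    ∑ᴸ (λ (u , v) → ∑< N (λ k → σ^ k R (j ∷ u) * (∂ k T ∘ₛ R) v)) (splits w)
      ≈⟨ ∑ᴸ-∑< N (λ (u , v) k → σ^ k R (j ∷ u) * (∂ k T ∘ₛ R) v) (splits w) ⟩
    ∑ˢ N (λ k → ∂ j (σ^ k R) · (∂ k T ∘ₛ R)) w
      ∎
    where
    open SetoidReasoning setoid
    term : Word → List Word → ℕ → Carrier
    term p ps k = σ^ k R p * plethTerm (∂ k T) R ps
    Φ : Word → List Word → Carrier
    Φ p ps = ∑< (suc (maxL p)) (term p ps)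
    -- σᵏR has no word beginning with a letter Xⱼ, j < k
    Φ-truncate : ∀ u ps → Φ (j ∷ u) ps ≈ ∑< N (term (j ∷ u) ps)
    Φ-truncate u ps =
      trans (∑<-truncate (suc (maxL (j ∷ u))) _ j (s≤s (ℕ.m≤m⊔n j (maxL u))) vanishes)
            (sym (∑<-truncate N _ j j<N vanishes))
      where
      vanishes : ∀ k → j < k → term (j ∷ u) ps k ≈ 0#
      vanishes k j<k = trans (*-congʳ (∂-σ^-< k j R j<k u)) (zeroˡ _)

  ∂-·-[]≈0 : ∀ j A B → A [] ≈ 0# → ∂ j (A · B) ≋ (∂ j A · B)
  ∂-·-[]≈0 j A B A[]≈0 w =
    trans (∂-· j A B w) (trans (+-congˡ (trans (*-congʳ A[]≈0) (zeroˡ _))) (+-identityʳ _))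

  one-∘ₛ : ∀ R → (one ∘ₛ R) ≋ one
  one-∘ₛ R []      = ∘ₛ-[] one R
  one-∘ₛ R (j ∷ w) = trans (∂-∘ₛ one R j (suc j) ℕ.≤-refl w)
    (∑ˢ-zero (suc j) (λ k _ → ·-∘ₛ-zeroˡ R (∂ j (σ^ k R)) ≋-refl) w)

  X₀·-∘ₛ : ∀ S R → R [] ≈ 0# → (X₀· S ∘ₛ R) ≋ (R · (S ∘ₛ R))
  X₀·-∘ₛ S R R[]≈0 []      =
    trans (∘ₛ-[] (X₀· S) R) (sym (trans (·-[] R (S ∘ₛ R)) (trans (*-congʳ R[]≈0) (zeroˡ _))))
  X₀·-∘ₛ S R R[]≈0 (j ∷ w) = begin
    ∂ j (X₀· S ∘ₛ R) w                                      ≈⟨ ∂-∘ₛ (X₀· S) R j (suc j) ℕ.≤-refl w ⟩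
    ∑ˢ (suc j) (λ k → ∂ j (σ^ k R) · (∂ k (X₀· S) ∘ₛ R)) w   ≈⟨ ∑ˢ-single (suc j) _ 0 (s≤s z≤n) only-X₀ w ⟩
    (∂ j (σ^ 0 R) · (S ∘ₛ R)) w                             ≈⟨ ·-congʳ (S ∘ₛ R) (∂-cong j (σ^-zero R)) w ⟩
    (∂ j R · (S ∘ₛ R)) w                                    ≈⟨ ∂-·-[]≈0 j R (S ∘ₛ R) R[]≈0 w ⟨
    ∂ j (R · (S ∘ₛ R)) w                                    ∎
    where
    open SetoidReasoning setoid
    only-X₀ : ∀ k → k ≢ 0 → (∂ j (σ^ k R) · (∂ k (X₀· S) ∘ₛ R)) ≋ 0ˢ
    only-X₀ zero    k≢0 = ⊥-elim (k≢0 ≡.refl)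
    only-X₀ (suc k) _   = ·-∘ₛ-zeroˡ R (∂ j (σ^ (suc k) R)) ≋-refl

  ∘ₛ-distribʳ-· : ∀ R S T → ((S · T) ∘ₛ R) ≋ ((S ∘ₛ R) · (T ∘ₛ R))
  ∘ₛ-distribʳ-· R S T = ≋[]⇒≋ (λ n → distrib[] n S T)
    where
    distrib-[] : ∀ S T → ((S · T) ∘ₛ R) [] ≈ ((S ∘ₛ R) · (T ∘ₛ R)) []
    distrib-[] S T = trans (∘ₛ-[] (S · T) R) (trans (·-[] S T)
      (sym (trans (·-[] (S ∘ₛ R) (T ∘ₛ R)) (*-cong (∘ₛ-[] S R) (∘ₛ-[] T R)))))
    distrib[] : ∀ n S T → (S · T) ∘ₛ R ≋[ n ] (S ∘ₛ R) · (T ∘ₛ R)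
    distrib[] zero    S T = distrib-[] S T
    distrib[] (suc n) S T = distrib-[] S T , ∂-distrib
      where
      ∂-distrib : ∀ j → ∂ j ((S · T) ∘ₛ R) ≋[ n ] ∂ j ((S ∘ₛ R) · (T ∘ₛ R))
      ∂-distrib j = begin
        ∂ j ((S · T) ∘ₛ R)
          ≋⟨ ∂-∘ₛ (S · T) R j N ℕ.≤-refl ⟩
        ∑ˢ N (λ k → E k · (∂ k (S · T) ∘ₛ R))
          ≋⟨ ∑ˢ-cong N (λ k _ → ·-congˡ (E k) (expand k)) ⟩
        ∑ˢ N (λ k → E k · ((∂ k S · T) ∘ₛ R +ˢ S [] • (∂ k T ∘ₛ R)))
          ≈⟨ ∑ˢ-cong[] n N (λ k → ·-cong[] n (≋[]-refl n {E k})
               (+ˢ-cong[] n (distrib[] n (∂ k S) T) (≋[]-refl n {S [] • (∂ k T ∘ₛ R)}))) ⟩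
        ∑ˢ N (λ k → E k · ((∂ k S ∘ₛ R) · (T ∘ₛ R) +ˢ S [] • (∂ k T ∘ₛ R)))
          ≋⟨ ∑ˢ-cong N (λ k _ → rearrange k) ⟩
        ∑ˢ N (λ k → (E k · (∂ k S ∘ₛ R)) · (T ∘ₛ R) +ˢ S [] • (E k · (∂ k T ∘ₛ R)))
          ≋⟨ ≋-trans (∑ˢ-distrib-+ˢ N (λ k → (E k · (∂ k S ∘ₛ R)) · (T ∘ₛ R)) (λ k → S [] • (E k · (∂ k T ∘ₛ R))))
               (+ˢ-cong (≋-sym (·-distribʳ-∑ˢ N (T ∘ₛ R) (λ k → E k · (∂ k S ∘ₛ R))))
                        (≋-sym (•-distrib-∑ˢ N (S []) (λ k → E k · (∂ k T ∘ₛ R))))) ⟩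
        ∑ˢ N (λ k → E k · (∂ k S ∘ₛ R)) · (T ∘ₛ R) +ˢ S [] • ∑ˢ N (λ k → E k · (∂ k T ∘ₛ R))
          ≋⟨ +ˢ-cong (·-congʳ (T ∘ₛ R) (∂-∘ₛ S R j N ℕ.≤-refl))
                     (≋-trans (•-congʳ (∂ j (T ∘ₛ R)) (∘ₛ-[] S R)) (•-congˡ (S []) (∂-∘ₛ T R j N ℕ.≤-refl))) ⟨
        ∂ j (S ∘ₛ R) · (T ∘ₛ R) +ˢ (S ∘ₛ R) [] • ∂ j (T ∘ₛ R)
          ≋⟨ ∂-· j (S ∘ₛ R) (T ∘ₛ R) ⟨
        ∂ j ((S ∘ₛ R) · (T ∘ₛ R))
          ∎
        where
        open ≋[]-Reasoning n
        N = suc j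
        E : ℕ → Ser
        E k = ∂ j (σ^ k R)
        expand : ∀ k → (∂ k (S · T) ∘ₛ R) ≋ ((∂ k S · T) ∘ₛ R +ˢ S [] • (∂ k T ∘ₛ R))
        expand k = ≋-trans (∘ₛ-congʳ R (∂-· k S T))
          (≋-trans (∘ₛ-distribʳ-+ˢ R (∂ k S · T) (S [] • ∂ k T)) (+ˢ-cong ≋-refl (∘ₛ-• R (S []) (∂ k T))))
        rearrange : ∀ k → (E k · ((∂ k S ∘ₛ R) · (T ∘ₛ R) +ˢ S [] • (∂ k T ∘ₛ R))) ≋
                          ((E k · (∂ k S ∘ₛ R)) · (T ∘ₛ R) +ˢ S [] • (E k · (∂ k T ∘ₛ R)))
        rearrange k = ≋-trans (·-distribˡ-+ˢ (E k) ((∂ k S ∘ₛ R) · (T ∘ₛ R)) (S [] • (∂ k T ∘ₛ R)))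
          (+ˢ-cong (≋-sym (·-assoc (E k) (∂ k S ∘ₛ R) (T ∘ₛ R))) (·-•-comm (S []) (E k) (∂ k T ∘ₛ R)))

  ∘ₛ-congˡ[] : ∀ n T {R R′} → R ≋[ n ] R′ → T ∘ₛ R ≋[ n ] T ∘ₛ R′
  ∘ₛ-congˡ[] zero    T {R} {R′} R≈R′ = trans (∘ₛ-[] T R) (sym (∘ₛ-[] T R′))
  ∘ₛ-congˡ[] (suc n) T {R} {R′} R≈R′ = trans (∘ₛ-[] T R) (sym (∘ₛ-[] T R′)) , λ j → begin
    ∂ j (T ∘ₛ R)
      ≋⟨ ∂-∘ₛ T R j (suc j) ℕ.≤-refl ⟩
    ∑ˢ (suc j) (λ k → ∂ j (σ^ k R) · (∂ k T ∘ₛ R))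
      ≈⟨ ∑ˢ-cong[] n (suc j) (λ k → ·-cong[] n (proj₂ (σ^-cong[] (suc n) k {R} {R′} R≈R′) j)
                                                (∘ₛ-congˡ[] n (∂ k T) (≋[]-pred n {R} {R′} R≈R′))) ⟩
    ∑ˢ (suc j) (λ k → ∂ j (σ^ k R′) · (∂ k T ∘ₛ R′))
      ≋⟨ ∂-∘ₛ T R′ j (suc j) ℕ.≤-refl ⟨
    ∂ j (T ∘ₛ R′)
      ∎
    where open ≋[]-Reasoning n

  σ^-∘ₛ : ∀ m T R → (σ^ m T ∘ₛ R) ≋ σ^ m (T ∘ₛ R)
  σ^-∘ₛ m T R = ≋[]⇒≋ (λ n → σ∘[] n T)
    where
    σ∘-[] : ∀ T → (σ^ m T ∘ₛ R) [] ≈ σ^ m (T ∘ₛ R) []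
    σ∘-[] T = trans (∘ₛ-[] (σ^ m T) R) (sym (∘ₛ-[] T R))
    σ∘[] : ∀ n T → σ^ m T ∘ₛ R ≋[ n ] σ^ m (T ∘ₛ R)
    σ∘[] zero    T = σ∘-[] T
    σ∘[] (suc n) T = σ∘-[] T , ∂σ∘
      where
      ∂σ∘ : ∀ j → ∂ j (σ^ m T ∘ₛ R) ≋[ n ] ∂ j (σ^ m (T ∘ₛ R))
      ∂σ∘ j with ℕ.≤-<-connex m j
      ... | inj₁ m≤j = begin
        ∂ j (σ^ m T ∘ₛ R)
          ≋⟨ ∂-∘ₛ (σ^ m T) R j (m ℕ.+ suc i) j<m+1+i ⟩
        ∑ˢ (m ℕ.+ suc i) (λ k → ∂ j (σ^ k R) · (∂ k (σ^ m T) ∘ₛ R))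
          ≋⟨ ∑ˢ-+ m (suc i) (λ k → ∂ j (σ^ k R) · (∂ k (σ^ m T) ∘ₛ R)) ⟩
        ∑ˢ m (λ k → ∂ j (σ^ k R) · (∂ k (σ^ m T) ∘ₛ R))
          +ˢ ∑ˢ (suc i) (λ l → ∂ j (σ^ (m ℕ.+ l) R) · (∂ (m ℕ.+ l) (σ^ m T) ∘ₛ R))
          ≋⟨ +ˢ-cong (∑ˢ-zero m (λ k k<m → ·-∘ₛ-zeroˡ R (∂ j (σ^ k R)) (∂-σ^-< m k T k<m)))
                     (∑ˢ-cong (suc i) (λ l _ → ·-cong (∂-σ^-σ^ l) (∘ₛ-congʳ R (∂-σ^-+ m l T)))) ⟩
        0ˢ +ˢ ∑ˢ (suc i) (λ l → σ^ m (∂ i (σ^ l R)) · (σ^ m (∂ l T) ∘ₛ R))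
          ≋⟨ (λ w → +-identityˡ _) ⟩
        ∑ˢ (suc i) (λ l → σ^ m (∂ i (σ^ l R)) · (σ^ m (∂ l T) ∘ₛ R))
          ≈⟨ ∑ˢ-cong[] n (suc i) (λ l → ·-cong[] n (≋[]-refl n {σ^ m (∂ i (σ^ l R))}) (σ∘[] n (∂ l T))) ⟩
        ∑ˢ (suc i) (λ l → σ^ m (∂ i (σ^ l R)) · σ^ m (∂ l T ∘ₛ R))
          ≋⟨ ≋-trans (σ^-∑ˢ m (suc i) (λ l → ∂ i (σ^ l R) · (∂ l T ∘ₛ R)))
                     (∑ˢ-cong (suc i) (λ l _ → σ^-· m (∂ i (σ^ l R)) (∂ l T ∘ₛ R))) ⟨
        σ^ m (∑ˢ (suc i) (λ l → ∂ i (σ^ l R) · (∂ l T ∘ₛ R)))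
          ≋⟨ σ^-cong m (∂-∘ₛ T R i (suc i) ℕ.≤-refl) ⟨
        σ^ m (∂ i (T ∘ₛ R))
          ≋⟨ ∂-σ^-≥ m j (T ∘ₛ R) m≤j ⟨
        ∂ j (σ^ m (T ∘ₛ R))
          ∎
        where
        open ≋[]-Reasoning n
        i = j ∸ m
        j<m+1+i : j < m ℕ.+ suc i
        j<m+1+i = ≡.subst (_< m ℕ.+ suc i) (ℕ.m+[n∸m]≡n m≤j) (ℕ.+-monoʳ-< m (ℕ.n<1+n i))
        ∂-σ^-σ^ : ∀ l → ∂ j (σ^ (m ℕ.+ l) R) ≋ σ^ m (∂ i (σ^ l R))
        ∂-σ^-σ^ l = ≋-trans (∂-cong j (≋-sym (σ^-σ^ m l R))) (∂-σ^-≥ m j (σ^ l R) m≤j)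
      ... | inj₂ j<m = ≋⇒≋[] n (begin
        ∂ j (σ^ m T ∘ₛ R)
          ≈⟨ ∂-∘ₛ (σ^ m T) R j (suc j) ℕ.≤-refl ⟩
        ∑ˢ (suc j) (λ k → ∂ j (σ^ k R) · (∂ k (σ^ m T) ∘ₛ R))
          ≈⟨ ∑ˢ-zero (suc j) (λ k k≤j →
               ·-∘ₛ-zeroˡ R (∂ j (σ^ k R)) (∂-σ^-< m k T (ℕ.≤-<-trans (ℕ.s≤s⁻¹ k≤j) j<m))) ⟩
        0ˢ
          ≈⟨ ∂-σ^-< m j (T ∘ₛ R) j<m ⟨
        ∂ j (σ^ m (T ∘ₛ R))
          ∎)
        where open SetoidReasoning ≋-setoid

  ∘ₛ-assoc : ∀ T R S → ((T ∘ₛ R) ∘ₛ S) ≋ (T ∘ₛ (R ∘ₛ S))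
  ∘ₛ-assoc T R S = ≋[]⇒≋ (λ n → assoc[] n T)
    where
    assoc-[] : ∀ T → ((T ∘ₛ R) ∘ₛ S) [] ≈ (T ∘ₛ (R ∘ₛ S)) []
    assoc-[] T = trans (∘ₛ-[] (T ∘ₛ R) S) (trans (∘ₛ-[] T R) (sym (∘ₛ-[] T (R ∘ₛ S))))
    assoc[] : ∀ n T → (T ∘ₛ R) ∘ₛ S ≋[ n ] T ∘ₛ (R ∘ₛ S)
    assoc[] zero    T = assoc-[] T
    assoc[] (suc n) T = assoc-[] T , ∂-assoc
      where
      ∂-assoc : ∀ j → ∂ j ((T ∘ₛ R) ∘ₛ S) ≋[ n ] ∂ j (T ∘ₛ (R ∘ₛ S))
      ∂-assoc j = begin
        ∂ j ((T ∘ₛ R) ∘ₛ S)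
          ≋⟨ ∂-∘ₛ (T ∘ₛ R) S j N ℕ.≤-refl ⟩
        ∑ˢ N (λ k → E k · (∂ k (T ∘ₛ R) ∘ₛ S))
          ≋⟨ ∑ˢ-cong N (λ k k<N → ·-congˡ (E k) (expand k k<N)) ⟩
        ∑ˢ N (λ k → E k · ∑ˢ N (λ m → F k m · ((∂ m T ∘ₛ R) ∘ₛ S)))
          ≈⟨ ∑ˢ-cong[] n N (λ k → ·-cong[] n (≋[]-refl n {E k}) (∑ˢ-cong[] n N (λ m →
               ·-cong[] n (≋[]-refl n {F k m}) (assoc[] n (∂ m T))))) ⟩
        ∑ˢ N (λ k → E k · ∑ˢ N (λ m → F k m · Z m))
          ≋⟨ ∑ˢ-cong N (λ k _ → ≋-trans (·-distribˡ-∑ˢ N (E k) (λ m → F k m · Z m))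
               (∑ˢ-cong N (λ m _ → ≋-sym (·-assoc (E k) (F k m) (Z m))))) ⟩
        ∑ˢ N (λ k → ∑ˢ N (λ m → (E k · F k m) · Z m))
          ≋⟨ ∑ˢ-comm N N (λ k m → (E k · F k m) · Z m) ⟩
        ∑ˢ N (λ m → ∑ˢ N (λ k → (E k · F k m) · Z m))
          ≋⟨ ∑ˢ-cong N (λ m _ → ·-distribʳ-∑ˢ N (Z m) (λ k → E k · F k m)) ⟨
        ∑ˢ N (λ m → ∑ˢ N (λ k → E k · F k m) · Z m)
          ≋⟨ ∑ˢ-cong N (λ m _ → ·-congʳ (Z m) (≋-sym (∂-∘ₛ (σ^ m R) S j N ℕ.≤-refl))) ⟩
        ∑ˢ N (λ m → ∂ j (σ^ m R ∘ₛ S) · Z m)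
          ≋⟨ ∑ˢ-cong N (λ m _ → ·-congʳ (Z m) (∂-cong j (σ^-∘ₛ m R S))) ⟩
        ∑ˢ N (λ m → ∂ j (σ^ m (R ∘ₛ S)) · Z m)
          ≋⟨ ∂-∘ₛ T (R ∘ₛ S) j N ℕ.≤-refl ⟨
        ∂ j (T ∘ₛ (R ∘ₛ S))
          ∎
        where
        open ≋[]-Reasoning n
        N = suc j
        E : ℕ → Ser
        E k = ∂ j (σ^ k S)
        F : ℕ → ℕ → Ser
        F k m = ∂ k (σ^ m R) ∘ₛ S
        Z : ℕ → Ser
        Z m = ∂ m T ∘ₛ (R ∘ₛ S)
        expand : ∀ k → k < N → (∂ k (T ∘ₛ R) ∘ₛ S) ≋ ∑ˢ N (λ m → F k m · ((∂ m T ∘ₛ R) ∘ₛ S))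
        expand k k<N = ≋-trans (∘ₛ-congʳ S (∂-∘ₛ T R k N k<N))
          (≋-trans (∘ₛ-distribʳ-∑ˢ S N (λ m → ∂ k (σ^ m R) · (∂ m T ∘ₛ R)))
                   (∑ˢ-cong N (λ m _ → ∘ₛ-distribʳ-· S (∂ k (σ^ m R)) (∂ m T ∘ₛ R))))

  ∘ₛ-identityʳ : ∀ T → (T ∘ₛ X₀) ≋ T
  ∘ₛ-identityʳ T = ≋[]⇒≋ (λ n → identity[] n T)
    where
    ∂-σ^-X₀ : ∀ j → ∂ j (σ^ j X₀) ≋ one
    ∂-σ^-X₀ j = ≋-trans (∂-σ^-≥ j j X₀ ℕ.≤-refl) (≋-trans (σ^-cong j ∂₀X₀≋one) (σ^-one j))
      where
      ∂₀X₀≋one : ∂ (j ∸ j) X₀ ≋ one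
      ∂₀X₀≋one rewrite ℕ.n∸n≡0 j = λ { [] → refl ; (_ ∷ _) → refl }
    ∂-σ^-X₀-≢ : ∀ j k → k ≢ j → ∂ j (σ^ k X₀) ≋ 0ˢ
    ∂-σ^-X₀-≢ j k k≢j with ℕ.≤-<-connex k j
    ... | inj₂ j<k = ∂-σ^-< k j X₀ j<k
    ... | inj₁ k≤j =
      ≋-trans (∂-σ^-≥ k j X₀ k≤j) (≋-trans (σ^-cong k (∂-X₀ (j ∸ k) j∸k≢0)) (σ^-0ˢ k))
      where
      j∸k≢0 : j ∸ k ≢ 0
      j∸k≢0 j∸k≡0 = k≢j (ℕ.≤-antisym k≤j (ℕ.m∸n≡0⇒m≤n j∸k≡0))
      ∂-X₀ : ∀ i → i ≢ 0 → ∂ i X₀ ≋ 0ˢ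
      ∂-X₀ zero    i≢0 = ⊥-elim (i≢0 ≡.refl)
      ∂-X₀ (suc i) _   = ≋-refl
    identity[] : ∀ n T → T ∘ₛ X₀ ≋[ n ] T
    identity[] zero    T = ∘ₛ-[] T X₀
    identity[] (suc n) T = ∘ₛ-[] T X₀ , ∂-identity
      where
      ∂-identity : ∀ j → ∂ j (T ∘ₛ X₀) ≋[ n ] ∂ j T
      ∂-identity j = begin
        ∂ j (T ∘ₛ X₀)                                    ≋⟨ ∂-∘ₛ T X₀ j (suc j) ℕ.≤-refl ⟩
        ∑ˢ (suc j) (λ k → ∂ j (σ^ k X₀) · (∂ k T ∘ₛ X₀))  ≋⟨ ∑ˢ-single (suc j) _ j ℕ.≤-refl other-letters ⟩
        ∂ j (σ^ j X₀) · (∂ j T ∘ₛ X₀)                    ≋⟨ ·-congʳ (∂ j T ∘ₛ X₀) (∂-σ^-X₀ j) ⟩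
        one · (∂ j T ∘ₛ X₀)                              ≋⟨ ·-identityˡ (∂ j T ∘ₛ X₀) ⟩
        ∂ j T ∘ₛ X₀                                      ≈⟨ identity[] n (∂ j T) ⟩
        ∂ j T                                            ∎
        where
        open ≋[]-Reasoning n
        other-letters : ∀ k → k ≢ j → (∂ j (σ^ k X₀) · (∂ k T ∘ₛ X₀)) ≋ 0ˢ
        other-letters k k≢j = ≋-trans (·-congʳ (∂ k T ∘ₛ X₀) (∂-σ^-X₀-≢ j k k≢j)) (·-zeroˡ _)

  X₀·-cong : ∀ {S S′} → S ≋ S′ → X₀· S ≋ X₀· S′
  X₀·-cong S≋S′ []          = refl
  X₀·-cong S≋S′ (zero ∷ w)  = S≋S′ w
  X₀·-cong S≋S′ (suc _ ∷ _) = refl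

  X₀·-one : X₀· one ≋ X₀
  X₀·-one []              = refl
  X₀·-one (zero ∷ [])     = refl
  X₀·-one (zero ∷ _ ∷ _)  = refl
  X₀·-one (suc _ ∷ _)     = refl

  X₀·-· : ∀ S T → (X₀· S · T) ≋ X₀· (S · T)
  X₀·-· S T []          = trans (·-[] (X₀· S) T) (zeroˡ _)
  X₀·-· S T (zero ∷ w)  = ∂-·-[]≈0 0 (X₀· S) T refl w
  X₀·-· S T (suc k ∷ w) = trans (∂-·-[]≈0 (suc k) (X₀· S) T refl w) (·-zeroˡ T w)

  ∘ₛ-fixedPoint-unique : ∀ B M {Y Z} → B [] ≈ 0# →
                         Y ≋ (B · (M ∘ₛ Y)) → Z ≋ (B · (M ∘ₛ Z)) → Y ≋ Z
  ∘ₛ-fixedPoint-unique B M {Y} {Z} B[]≈0 Y-fix Z-fix = ≋[]⇒≋ unique[]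
    where
    fix-[] : ∀ {Y} → Y ≋ (B · (M ∘ₛ Y)) → Y [] ≈ 0#
    fix-[] {Y} Y-fix = trans (Y-fix []) (trans (·-[] B (M ∘ₛ Y)) (trans (*-congʳ B[]≈0) (zeroˡ _)))
    ∂-fix : ∀ {Y} → Y ≋ (B · (M ∘ₛ Y)) → ∀ j → ∂ j Y ≋ (∂ j B · (M ∘ₛ Y))
    ∂-fix {Y} Y-fix j = ≋-trans (∂-cong j Y-fix) (∂-·-[]≈0 j B (M ∘ₛ Y) B[]≈0)
    unique[] : ∀ n → Y ≋[ n ] Z
    unique[] zero    = trans (fix-[] Y-fix) (sym (fix-[] Z-fix))
    unique[] (suc n) = trans (fix-[] Y-fix) (sym (fix-[] Z-fix)) , λ j → begin
      ∂ j Y                 ≋⟨ ∂-fix Y-fix j ⟩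
      ∂ j B · (M ∘ₛ Y)      ≈⟨ ·-cong[] n (≋[]-refl n {∂ j B}) (∘ₛ-congˡ[] n M (unique[] n)) ⟩
      ∂ j B · (M ∘ₛ Z)      ≋⟨ ∂-fix Z-fix j ⟨
      ∂ j Z                 ∎
      where open ≋[]-Reasoning n

mainTheorem11 : ∀ {c ℓ} (K : CommutativeRing c ℓ) → IsField K → CharZero K →
    let open CommutativeRing K in
    let open Series K in
    (M Minv 𝒜 : Ser) → M [] ≈ 1# →
    (M · Minv) ≋ one → (Minv · M) ≋ one →
    𝒜 ≋ X₀· (M ∘ₛ 𝒜) →
    ((𝒜 ∘ₛ X₀· Minv) ≋ X₀) × ((X₀· Minv ∘ₛ 𝒜) ≋ X₀)
mainTheorem11 K _ _ M M⁻¹ 𝒜 _ M·M⁻¹≋one M⁻¹·M≋one 𝒜-tree = 𝒜∘B≋X₀ , B∘𝒜≋X₀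
  where
  open CommutativeRing K using (refl)
  open Series K
  open ShiftPlethysm K
  open SetoidReasoning ≋-setoid
  B : Ser
  B = X₀· M⁻¹
  B∘𝒜≋X₀ : (B ∘ₛ 𝒜) ≋ X₀
  B∘𝒜≋X₀ = begin
    B ∘ₛ 𝒜                         ≈⟨ X₀·-∘ₛ M⁻¹ 𝒜 (𝒜-tree []) ⟩
    𝒜 · (M⁻¹ ∘ₛ 𝒜)                 ≈⟨ ·-congʳ (M⁻¹ ∘ₛ 𝒜) 𝒜-tree ⟩
    X₀· (M ∘ₛ 𝒜) · (M⁻¹ ∘ₛ 𝒜)      ≈⟨ X₀·-· (M ∘ₛ 𝒜) (M⁻¹ ∘ₛ 𝒜) ⟩
    X₀· ((M ∘ₛ 𝒜) · (M⁻¹ ∘ₛ 𝒜))    ≈⟨ X₀·-cong (∘ₛ-distribʳ-· 𝒜 M M⁻¹) ⟨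
    X₀· ((M · M⁻¹) ∘ₛ 𝒜)           ≈⟨ X₀·-cong (≋-trans (∘ₛ-congʳ 𝒜 M·M⁻¹≋one) (one-∘ₛ 𝒜)) ⟩
    X₀· one                        ≈⟨ X₀·-one ⟩
    X₀                             ∎
  𝒜∘B-fix : (𝒜 ∘ₛ B) ≋ (B · (M ∘ₛ (𝒜 ∘ₛ B)))
  𝒜∘B-fix = begin
    𝒜 ∘ₛ B                   ≈⟨ ∘ₛ-congʳ B 𝒜-tree ⟩
    X₀· (M ∘ₛ 𝒜) ∘ₛ B        ≈⟨ X₀·-∘ₛ (M ∘ₛ 𝒜) B refl ⟩
    B · ((M ∘ₛ 𝒜) ∘ₛ B)      ≈⟨ ·-congˡ B (∘ₛ-assoc M 𝒜 B) ⟩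
    B · (M ∘ₛ (𝒜 ∘ₛ B))      ∎
  X₀-fix : X₀ ≋ (B · (M ∘ₛ X₀))
  X₀-fix = begin
    X₀                       ≈⟨ X₀·-one ⟨
    X₀· one                  ≈⟨ X₀·-cong M⁻¹·M≋one ⟨
    X₀· (M⁻¹ · M)            ≈⟨ X₀·-· M⁻¹ M ⟨
    B · M                    ≈⟨ ·-congˡ B (∘ₛ-identityʳ M) ⟨
    B · (M ∘ₛ X₀)            ∎
  𝒜∘B≋X₀ : (𝒜 ∘ₛ B) ≋ X₀
  𝒜∘B≋X₀ = ∘ₛ-fixedPoint-unique B M refl 𝒜∘B-fix X₀-fix
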